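{- Every CMV-algebra is functional: for every CMV-algebra $\mathbf{A}=\langle A,\oplus,{}^*,0,\diamond,i\rangle$ there is an MV-algebra $\mathbf{M}$ (namely the MV-reduct of $\mathbf{A}$) such that $\mathbf{A}$ is isomorphic to a CMV-subalgebra of the CMV-algebra $\langle M^M,\oplus,{}^*,0,\circ,\mathrm{id}_M\rangle$.
   Context: An MV-algebra is a structure $\langle M,\oplus,{}^*,0\rangle$ of type $(2,1,0)$ satisfying: $(x\oplus y)\oplus z=x\oplus(y\oplus z)$, $x\oplus y=y\oplus x$, $x\oplus 0=x$, $(x^*)^*=x$, $x\oplus 0^*=0^*$, $(x^*\oplus y)^*\oplus y=(y^*\oplus x)^*\oplus x$. A CMV-algebra is a structure $\langle A,\oplus,{}^*,0,\diamond,i\rangle$ such that $\langle A,\oplus,{}^*,0\rangle$ is an MV-algebra, $\langle A,\diamond,i\rangle$ is a monoid, and for all $x,y,z$: $(y\oplus z)\diamond x=(y\diamond x)\oplus(z\diamond x)$, $x^*\diamond y=(x\diamond y)^*$, $0\diamond x=0$. Morphisms of CMV-algebras preserve $\oplus,{}^*,0,\diamond,i$. For an MV-algebra $\mathbf{M}$, $M^M$ is the set of all functions $M\to M$ with pointwise operations $\oplus,{}^*,0$, function composition $\circ$ and the identity $\mathrm{id}_M$; this is a CMV-algebra. A CMV-algebra is called functional if it is a subalgebra of such an $M^M$. -}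

module Defs where

open import Level using (Level; suc; _⊔_)
open import Relation.Binary.PropositionalEquality using (_≡_)
open import Data.Product using (Σ; _×_; ∃)
open import Function using (_∘_; id)

-- Carrier equality is propositional equality.  Functions M → M are compared
-- pointwise (_≗_), since Agda has no function extensionality.

record MVAlgebra (ℓ : Level) : Set (suc ℓ) where
  infixl 6 _⊕_
  field
    Carrier : Set ℓ
    _⊕_     : Carrier → Carrier → Carrier
    _*      : Carrier → Carrier
    𝟘       : Carrier
    ⊕-assoc : ∀ x y z → (x ⊕ y) ⊕ z ≡ x ⊕ (y ⊕ z)
    ⊕-comm  : ∀ x y → x ⊕ y ≡ y ⊕ x
    ⊕-identʳ : ∀ x → x ⊕ 𝟘 ≡ x
    *-invol : ∀ x → (x *) * ≡ x
    ⊕-absorb : ∀ x → x ⊕ (𝟘 *) ≡ 𝟘 *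
    luk     : ∀ x y → ((x *) ⊕ y) * ⊕ y ≡ ((y *) ⊕ x) * ⊕ x

record CMVAlgebra (ℓ : Level) : Set (suc ℓ) where
  field
    mv : MVAlgebra ℓ
  open MVAlgebra mv public
  infixl 7 _⋄_
  field
    _⋄_      : Carrier → Carrier → Carrier
    i        : Carrier
    ⋄-assoc  : ∀ x y z → (x ⋄ y) ⋄ z ≡ x ⋄ (y ⋄ z)
    ⋄-identˡ : ∀ x → i ⋄ x ≡ x
    ⋄-identʳ : ∀ x → x ⋄ i ≡ x
    ⋄-distrib : ∀ x y z → (y ⊕ z) ⋄ x ≡ (y ⋄ x) ⊕ (z ⋄ x)
    *-⋄      : ∀ x y → (x *) ⋄ y ≡ (x ⋄ y) *
    𝟘-⋄      : ∀ x → 𝟘 ⋄ x ≡ 𝟘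

_≗_ : ∀ {ℓ} {M : Set ℓ} → (M → M) → (M → M) → Set ℓ
f ≗ g = ∀ x → f x ≡ g x

module FullFunctional {ℓ} (M : MVAlgebra ℓ) where
  open MVAlgebra M
  End : Set ℓ
  End = Carrier → Carrier
  _⊕ᶠ_ : End → End → End
  (f ⊕ᶠ g) x = f x ⊕ g x
  _*ᶠ : End → End
  (f *ᶠ) x = (f x) *
  𝟘ᶠ : End
  𝟘ᶠ x = 𝟘
  _∘ᶠ_ : End → End → End
  f ∘ᶠ g = f ∘ g
  idᶠ : End
  idᶠ = id

record IsCMVSubalgebra {ℓ} (M : MVAlgebra ℓ) (S : (MVAlgebra.Carrier M → MVAlgebra.Carrier M) → Set ℓ) : Set ℓ where
  open FullFunctional M
  field
    resp   : ∀ {f g} → f ≗ g → S f → S g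
    ⊕-closed : ∀ {f g} → S f → S g → S (f ⊕ᶠ g)
    *-closed : ∀ {f} → S f → S (f *ᶠ)
    𝟘-closed : S 𝟘ᶠ
    ∘-closed : ∀ {f g} → S f → S g → S (f ∘ᶠ g)
    id-closed : S idᶠ

record IsIsoOnto {ℓ} (A : CMVAlgebra ℓ) (M : MVAlgebra ℓ)
    (S : (MVAlgebra.Carrier M → MVAlgebra.Carrier M) → Set ℓ)
    (φ : CMVAlgebra.Carrier A → MVAlgebra.Carrier M → MVAlgebra.Carrier M) : Set ℓ where
  open CMVAlgebra A
  open FullFunctional M
  field
    into    : ∀ a → S (φ a)
    pres-⊕  : ∀ a b → φ (a ⊕ b) ≗ (φ a ⊕ᶠ φ b)
    pres-*  : ∀ a → φ (a *) ≗ (φ a *ᶠ)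
    pres-𝟘  : φ 𝟘 ≗ 𝟘ᶠ
    pres-⋄  : ∀ a b → φ (a ⋄ b) ≗ (φ a ∘ᶠ φ b)
    pres-i  : φ i ≗ idᶠ
    injective : ∀ a b → φ a ≗ φ b → a ≡ b
    onto    : ∀ f → S f → Σ Carrier (λ a → φ a ≗ f)

module Submission where

-- The proof follows Cayley's theorem for monoids.  A CMV-algebra A acts on
-- its own MV-reduct M by left multiplication, a ↦ λₐ = (a ⋄_).  The axioms
-- of a CMV-algebra say exactly that this is a homomorphism into M^M:
-- right distributivity of ⋄ over ⊕ and *, 0 ⋄ x = 0, associativity of ⋄ and
-- i ⋄ x = x give preservation of ⊕, *, 0, ⋄ (as composition) and i.  The
-- right unit law a ⋄ i = a makes it injective, since λₐ i = a.

open import Defs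
open import Data.Product using (Σ; _×_; _,_)
open import Relation.Binary.PropositionalEquality
  using (_≡_; refl; sym; trans; cong; cong₂; module ≡-Reasoning)

record IsPointwiseHom {ℓ} (A : CMVAlgebra ℓ) (M : MVAlgebra ℓ)
    (φ : CMVAlgebra.Carrier A → MVAlgebra.Carrier M → MVAlgebra.Carrier M) : Set ℓ where
  open CMVAlgebra A
  open FullFunctional M
  field
    pres-⊕ : ∀ a b → φ (a ⊕ b) ≗ (φ a ⊕ᶠ φ b)
    pres-* : ∀ a → φ (a *) ≗ (φ a *ᶠ)
    pres-𝟘 : φ 𝟘 ≗ 𝟘ᶠ
    pres-⋄ : ∀ a b → φ (a ⋄ b) ≗ (φ a ∘ᶠ φ b)
    pres-i : φ i ≗ idᶠ

module Image {ℓ} (A : CMVAlgebra ℓ) (M : MVAlgebra ℓ)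
    (φ : CMVAlgebra.Carrier A → MVAlgebra.Carrier M → MVAlgebra.Carrier M) where
  open CMVAlgebra A using (Carrier; _⊕_; _*; 𝟘; _⋄_; i)
  module M = MVAlgebra M
  open FullFunctional M

  Im : End → Set ℓ
  Im f = Σ Carrier (λ a → φ a ≗ f)

  image-isSubalgebra : IsPointwiseHom A M φ → IsCMVSubalgebra M Im
  image-isSubalgebra hom = record
    { resp      = λ { f≗g (a , φa≗f) → a , λ x → trans (φa≗f x) (f≗g x) }
    ; ⊕-closed  = λ { (a , φa≗f) (b , φb≗g) →
                      a ⊕ b , λ x → trans (pres-⊕ a b x) (cong₂ M._⊕_ (φa≗f x) (φb≗g x)) }
    ; *-closed  = λ { (a , φa≗f) → a * , λ x → trans (pres-* a x) (cong M._* (φa≗f x)) }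
    ; 𝟘-closed  = 𝟘 , pres-𝟘
    ; ∘-closed  = λ { (a , φa≗f) (b , φb≗g) →
                      a ⋄ b , λ x → trans (pres-⋄ a b x)
                                          (trans (cong (φ a) (φb≗g x)) (φa≗f _)) }
    ; id-closed = i , pres-i
    }
    where open IsPointwiseHom hom

  injectiveHom-isIsoOntoImage : IsPointwiseHom A M φ →
    (∀ a b → φ a ≗ φ b → a ≡ b) → IsIsoOnto A M Im φ
  injectiveHom-isIsoOntoImage hom inj = record
    { into      = λ a → a , λ _ → refl
    ; pres-⊕    = pres-⊕
    ; pres-*    = pres-*
    ; pres-𝟘    = pres-𝟘
    ; pres-⋄    = pres-⋄
    ; pres-i    = pres-i
    ; injective = inj
    ; onto      = λ _ f∈Im → f∈Im
    }
    where open IsPointwiseHom hom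

module LeftRegular {ℓ} (A : CMVAlgebra ℓ) where
  open CMVAlgebra A

  leftMul : Carrier → Carrier → Carrier
  leftMul a x = a ⋄ x

  leftMul-isHom : IsPointwiseHom A mv leftMul
  leftMul-isHom = record
    { pres-⊕ = λ a b x → ⋄-distrib x a b
    ; pres-* = *-⋄
    ; pres-𝟘 = 𝟘-⋄
    ; pres-⋄ = ⋄-assoc
    ; pres-i = ⋄-identˡ
    }

  leftMul-injective : ∀ a b → leftMul a ≗ leftMul b → a ≡ b
  leftMul-injective a b a⋄≗b⋄ = begin
    a      ≡⟨ sym (⋄-identʳ a) ⟩
    a ⋄ i  ≡⟨ a⋄≗b⋄ i ⟩
    b ⋄ i  ≡⟨ ⋄-identʳ b ⟩
    b      ∎
    where open ≡-Reasoning

mainTheorem4 : ∀ {ℓ} (A : CMVAlgebra ℓ) →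
    Σ ((MVAlgebra.Carrier (CMVAlgebra.mv A) → MVAlgebra.Carrier (CMVAlgebra.mv A)) → Set ℓ) λ S →
    Σ (CMVAlgebra.Carrier A → MVAlgebra.Carrier (CMVAlgebra.mv A) → MVAlgebra.Carrier (CMVAlgebra.mv A)) λ φ →
    IsCMVSubalgebra (CMVAlgebra.mv A) S × IsIsoOnto A (CMVAlgebra.mv A) S φ
mainTheorem4 A =
    Im , leftMul
  , image-isSubalgebra leftMul-isHom
  , injectiveHom-isIsoOntoImage leftMul-isHom leftMul-injective
  where
  open LeftRegular A
  open Image A (CMVAlgebra.mv A) leftMul
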